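{- For an arbitrary $\mathbf{a} = (a_1,\ldots,a_n) \in \mathbb{Z}^n$ we have $L(\mathbf{a}) \ll \log^2 \mathfrak{H}(\mathbf{a})$, where the implied constant may depend on $n$.
   Context: For $\mathbf{x} \in \mathbb{Z}^n$, the height is $\mathfrak{H}(\mathbf{x}) = \max\{|x_1|,\ldots,|x_n|\}$. For $\mathbf{a} \in \mathbb{Z}^n$, $L(\mathbf{a})$ denotes the smallest $H$ such that there is a vector $\mathbf{h} = (h_1,\ldots,h_n) \in \mathbb{Z}^n$ with $\mathfrak{H}(\mathbf{h}) = H$ and $\gcd(a_i+h_i, a_j+h_j) = 1$ for all $1 \le i < j \le n$. The notation $U \ll V$ means $|U| \le c|V|$ for some constant $c>0$. -}

module Defs where

open import Data.Nat using (ℕ; zero; suc; _⊔_; _≤_)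
open import Data.Integer using (ℤ; ∣_∣; _+_; 1ℤ)
open import Data.Integer.GCD using (gcd)
open import Data.Fin using (Fin; _<_)
import Data.Fin as Fin
open import Data.Product using (Σ; _×_)
open import Relation.Binary.PropositionalEquality using (_≡_)

height : ∀ {n} → (Fin n → ℤ) → ℕ
height {zero}  x = 0
height {suc n} x = ∣ x Fin.zero ∣ ⊔ height (λ i → x (Fin.suc i))

PairwiseCoprimeShift : ∀ {n} → (Fin n → ℤ) → (Fin n → ℤ) → Set
PairwiseCoprimeShift {n} a h =
  (i j : Fin n) → i < j → gcd (a i + h i) (a j + h j) ≡ 1ℤ

-- "H = L(a)": H is the smallest height of a vector h making a + h pairwise coprime,
-- i.e. H is attained and is a lower bound for all admissible h.
IsL : ∀ {n} → (Fin n → ℤ) → ℕ → Set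
IsL {n} a H =
  Σ (Fin n → ℤ) (λ h → height h ≡ H × PairwiseCoprimeShift a h)
  × ((h : Fin n → ℤ) → PairwiseCoprimeShift a h → H ≤ height h)

{-# OPTIONS --safe #-}

-- Put Q = 2 + 8n² and M = Q!, and move each a_i into the progression
-- b_i(t) = a_i + r_i + M t, with 0 ≤ r_i < M chosen so that b_i(t) ≡ 1 (mod M).
-- Then b_i(t) has no divisor in [2, Q], and a common divisor of b_i(s) and b_i(t)
-- divides t − s. For s, t < T, the pairs where b_i(s) and b_j(t) share a divisor
-- d ∈ (Q, T] number at most ∑_{d > Q} (2T/d)² ≤ 4T²/Q, while for fixed s the other
-- non-coprime pairs give pairwise coprime divisors ≥ 2 of b_i(s) < 2^e, so there are
-- fewer than e of them. With e ≍ T ≍ log H each pair (i, j) is bad for fewer than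
-- T²/n² of the (s, t), so a union bound over [0, T)ⁿ leaves some x for which all
-- b_i(x_i) are pairwise coprime; the shift h_i = r_i + M x_i has height < M T ≪ log H,
-- and the least admissible height is then found by exhaustive search.

module Submission where

open import Level using (0ℓ)
open import Function using (_∘_)
open import Data.Nat using (ℕ; zero; suc; pred; _+_; _*_; _∸_; _^_; _/_; _%_; _!; _≤_; _<_; z≤n; s≤s;
  _<?_; _≤?_; NonZero; >-nonZero; ≢-nonZero; ≢-nonZero⁻¹)
open import Data.Nat.Properties
open import Data.Nat.DivMod using (m≡m%n+[m/n]*n; m%n<n)
open import Data.Nat.Divisibility using (_∣_; _∣?_; 1∣_; _∣0; ∣-refl; ∣-trans; ∣⇒≤; ∣1⇒≡1; 0∣⇒≡0; m∣m*n; m≤n⇒m!∣n!)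
open import Data.Nat.Coprimality using (Coprime; coprime?; coprime-divisor; coprime⇒gcd≡1; gcd≡1⇒coprime; 1-coprimeTo)
open import Data.Nat.GCD using (gcd; gcd[m,n]∣m; gcd[m,n]∣n; gcd[m,n]≡0⇒m≡0)
open import Data.Nat.LCM using (lcm; lcm-least; gcd*lcm)
open import Data.Nat.Logarithm using (⌊log₂_⌋; ⌊log₂⌋-mono-≤; ⌊log₂[2^n]⌋≡n)
open import Data.Nat.Tactic.RingSolver using (solve-∀)
open import Algebra.Properties.CommutativeSemigroup *-commutativeSemigroup using (x∙yz≈y∙xz)
open import Data.Integer as ℤ using (ℤ; -[1+_]; -_; ∣_∣; 1ℤ) renaming (_+_ to _+ℤ_; _*_ to _*ℤ_; _-_ to _-ℤ_)
import Data.Integer.Properties as ℤₚ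
open import Data.Integer.DivMod using (_%ℕ_; _/ℕ_; a≡a%ℕn+[a/ℕn]*n; n%ℕd<d)
import Data.Integer.Divisibility.Signed as ℤ∣
import Data.Integer.Tactic.RingSolver as ℤ-Ring
open import Data.Fin using (Fin; zero; suc)
import Data.Fin as Fin
open import Data.Fin.Properties using (any?; all?)
open import Data.Vec.Functional using (Vector; []; _∷_; head; tail)
open import Data.Product using (Σ; ∃; _×_; _,_; proj₁; proj₂)
open import Data.Sum using (_⊎_; inj₁; inj₂)
open import Relation.Nullary using (Dec; yes; no; ¬_; ¬?; contradiction)
open import Relation.Nullary.Decidable using (_×-dec_; _⊎-dec_; _→-dec_; map′; decidable-stable)
open import Relation.Unary using (Pred; Decidable)
import Relation.Binary as B
open import Relation.Binary using (_Respects_)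
open import Relation.Binary.PropositionalEquality
open import Defs

∑< : ℕ → (ℕ → ℕ) → ℕ
∑< zero    f = 0
∑< (suc T) f = ∑< T f + f T

syntax ∑< T (λ t → e) = ∑[ t < T ] e

module _ {f g : ℕ → ℕ} where

  ∑-cong : ∀ T → (∀ t → t < T → f t ≡ g t) → ∑< T f ≡ ∑< T g
  ∑-cong zero    f≡g = refl
  ∑-cong (suc T) f≡g = cong₂ _+_ (∑-cong T λ t t<T → f≡g t (m<n⇒m<1+n t<T)) (f≡g T ≤-refl)

  ∑-mono-≤ : ∀ T → (∀ t → t < T → f t ≤ g t) → ∑< T f ≤ ∑< T g
  ∑-mono-≤ zero    f≤g = z≤n
  ∑-mono-≤ (suc T) f≤g = +-mono-≤ (∑-mono-≤ T λ t t<T → f≤g t (m<n⇒m<1+n t<T)) (f≤g T ≤-refl)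

  ∑-distrib-+ : ∀ T → ∑[ t < T ] (f t + g t) ≡ ∑< T f + ∑< T g
  ∑-distrib-+ zero    = refl
  ∑-distrib-+ (suc T) rewrite ∑-distrib-+ T = shuffle (∑< T f) (∑< T g) (f T) (g T)
    where
    shuffle : ∀ a b c d → a + b + (c + d) ≡ a + c + (b + d)
    shuffle = solve-∀

*-distribˡ-∑ : ∀ c (f : ℕ → ℕ) T → ∑[ t < T ] (c * f t) ≡ c * ∑< T f
*-distribˡ-∑ c f zero    = sym (*-zeroʳ c)
*-distribˡ-∑ c f (suc T) rewrite *-distribˡ-∑ c f T = sym (*-distribˡ-+ c (∑< T f) (f T))

∑-const : ∀ c T → ∑[ t < T ] c ≡ T * c
∑-const c zero    = refl
∑-const c (suc T) rewrite ∑-const c T = +-comm (T * c) c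

∑-zero : ∀ (f : ℕ → ℕ) T → (∀ t → t < T → f t ≡ 0) → ∑< T f ≡ 0
∑-zero f T f≡0 = trans (∑-cong T f≡0) (trans (∑-const 0 T) (*-zeroʳ T))

∑-++ : ∀ (f : ℕ → ℕ) T U → ∑< (T + U) f ≡ ∑< T f + ∑[ u < U ] f (T + u)
∑-++ f T zero    rewrite +-identityʳ T = sym (+-identityʳ _)
∑-++ f T (suc U) rewrite +-suc T U | ∑-++ f T U = +-assoc (∑< T f) _ _

∑-comm : ∀ (h : ℕ → ℕ → ℕ) T U → ∑[ s < T ] ∑[ d < U ] h s d ≡ ∑[ d < U ] ∑[ s < T ] h s d
∑-comm h zero    U = sym (∑-zero (λ _ → 0) U λ _ _ → refl)
∑-comm h (suc T) U rewrite ∑-comm h T U = sym (∑-distrib-+ {λ d → ∑[ s < T ] h s d} {h T} U)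

term≤∑ : ∀ (f : ℕ → ℕ) {T t} → t < T → f t ≤ ∑< T f
term≤∑ f {suc T} t<1+T with m≤n⇒m<n∨m≡n (≤-pred t<1+T)
... | inj₁ t<T  = ≤-trans (term≤∑ f t<T) (m≤m+n (∑< T f) (f T))
... | inj₂ refl = m≤n+m (f T) (∑< T f)

∑<*⇒∃< : ∀ (f : ℕ → ℕ) T X → ∑< T f < T * X → ∃ λ t → t < T × f t < X
∑<*⇒∃< f (suc T) X ∑<TX with f T <? X
... | yes fT<X = T , ≤-refl , fT<X
... | no  fT≮X with ∑<*⇒∃< f T X (+-cancelʳ-< X (∑< T f) (T * X) ∑f<T*X+X)
  where
  ∑f<T*X+X : ∑< T f + X < T * X + X
  ∑f<T*X+X = ≤-trans (s≤s (+-monoʳ-≤ (∑< T f) (≮⇒≥ fT≮X)))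
                     (≤-trans ∑<TX (≤-reflexive (+-comm X (T * X))))
... | t , t<T , ft<X = t , m<n⇒m<1+n t<T , ft<X

𝟙 : ∀ {A : Set} → Dec A → ℕ
𝟙 (yes _) = 1
𝟙 (no  _) = 0

𝟙-mono : ∀ {A B : Set} (A? : Dec A) (B? : Dec B) → (A → B) → 𝟙 A? ≤ 𝟙 B?
𝟙-mono (yes a) (yes _) A⇒B = ≤-refl
𝟙-mono (yes a) (no ¬b) A⇒B = contradiction (A⇒B a) ¬b
𝟙-mono (no _)  B?      A⇒B = z≤n

𝟙-× : ∀ {A B : Set} (A? : Dec A) (B? : Dec B) → 𝟙 (A? ×-dec B?) ≡ 𝟙 A? * 𝟙 B?
𝟙-× (yes _) (yes _) = refl
𝟙-× (yes _) (no _)  = refl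
𝟙-× (no _)  B?      = refl

𝟙-∅ : ∀ {A : Set} (A? : Dec A) → ¬ A → 𝟙 A? ≡ 0
𝟙-∅ (yes a) ¬a = contradiction a ¬a
𝟙-∅ (no _)  ¬a = refl

𝟙-⊎ : ∀ {A B C : Set} (A? : Dec A) (B? : Dec B) (C? : Dec C) → (A → B ⊎ C) → 𝟙 A? ≤ 𝟙 B? + 𝟙 C?
𝟙-⊎ (no _)  B?      C?      A⇒B⊎C = z≤n
𝟙-⊎ (yes a) (yes _) C?      A⇒B⊎C = s≤s z≤n
𝟙-⊎ (yes a) (no ¬b) (yes _) A⇒B⊎C = s≤s z≤n
𝟙-⊎ (yes a) (no ¬b) (no ¬c) A⇒B⊎C with A⇒B⊎C a
... | inj₁ b = contradiction b ¬b
... | inj₂ c = contradiction c ¬c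

count : {P : Pred ℕ 0ℓ} → Decidable P → ℕ → ℕ
count P? T = ∑[ t < T ] 𝟙 (P? t)

module _ {P : Pred ℕ 0ℓ} (P? : Decidable P) where

  count-mono : {R : Pred ℕ 0ℓ} (R? : Decidable R) → ∀ T → (∀ t → t < T → P t → R t) → count P? T ≤ count R? T
  count-mono R? T P⇒R = ∑-mono-≤ T λ t t<T → 𝟙-mono (P? t) (R? t) (P⇒R t t<T)

  count-⊎ : {R S : Pred ℕ 0ℓ} (R? : Decidable R) (S? : Decidable S) → ∀ T → (∀ t → P t → R t ⊎ S t) →
            count P? T ≤ count R? T + count S? T
  count-⊎ R? S? T P⇒R⊎S = ≤-trans (∑-mono-≤ T λ t _ → 𝟙-⊎ (P? t) (R? t) (S? t) (P⇒R⊎S t))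
                                  (≤-reflexive (∑-distrib-+ T))

  count-∅ : ∀ T → (∀ t → t < T → ¬ P t) → count P? T ≡ 0
  count-∅ T ¬P = ∑-zero _ T λ t t<T → 𝟙-∅ (P? t) (¬P t t<T)

  count>0⇒∃ : ∀ T → 0 < count P? T → ∃ λ t → t < T × P t
  count>0⇒∃ (suc T) count>0 with P? T
  ... | yes p = T , ≤-refl , p
  ... | no _ with count>0⇒∃ T (subst (0 <_) (+-identityʳ _) count>0)
  ...   | t , t<T , p = t , m<n⇒m<1+n t<T , p

  count-∃ : {R : ℕ → Pred ℕ 0ℓ} (R? : ∀ d → Decidable (R d)) → ∀ T U →
            (∀ t → t < T → P t → ∃ λ d → d < U × R d t) →
            count P? T ≤ ∑[ d < U ] count (R? d) T
  count-∃ {R} R? T U P⇒∃R = begin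
    count P? T                      ≤⟨ ∑-mono-≤ T 𝟙≤∑𝟙 ⟩
    ∑[ t < T ] ∑[ d < U ] 𝟙 (R? d t) ≡⟨ ∑-comm (λ t d → 𝟙 (R? d t)) T U ⟩
    ∑[ d < U ] count (R? d) T        ∎
    where
    open ≤-Reasoning
    𝟙≤∑𝟙 : ∀ t → t < T → 𝟙 (P? t) ≤ ∑[ d < U ] 𝟙 (R? d t)
    𝟙≤∑𝟙 t t<T with P? t
    ... | no _ = z≤n
    ... | yes p with P⇒∃R t t<T p
    ...   | d , d<U , r = ≤-trans (𝟙-mono (yes p) (R? d t) λ _ → r) (term≤∑ (λ d → 𝟙 (R? d t)) d<U)

count² : {R : B.Rel ℕ 0ℓ} → B.Decidable R → ℕ → ℕ
count² R? T = ∑[ s < T ] count (R? s) T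

count²-× : {P R : Pred ℕ 0ℓ} (P? : Decidable P) (R? : Decidable R) → ∀ T →
           count² (λ s t → P? s ×-dec R? t) T ≡ count P? T * count R? T
count²-× P? R? T = begin
  ∑[ s < T ] ∑[ t < T ] 𝟙 (P? s ×-dec R? t) ≡⟨ ∑-cong T (λ s _ → ∑-cong T λ t _ → 𝟙-× (P? s) (R? t)) ⟩
  ∑[ s < T ] ∑[ t < T ] (𝟙 (P? s) * 𝟙 (R? t)) ≡⟨ ∑-cong T (λ s _ → *-distribˡ-∑ (𝟙 (P? s)) _ T) ⟩
  ∑[ s < T ] (𝟙 (P? s) * count R? T)        ≡⟨ ∑-cong T (λ s _ → *-comm (𝟙 (P? s)) _) ⟩
  ∑[ s < T ] (count R? T * 𝟙 (P? s))        ≡⟨ *-distribˡ-∑ (count R? T) _ T ⟩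
  count R? T * count P? T                  ≡⟨ *-comm (count R? T) _ ⟩
  count P? T * count R? T                  ∎
  where open ≡-Reasoning

Separated : ℕ → Pred ℕ 0ℓ → Set
Separated d P = ∀ {s t} → s < t → P s → P t → d ≤ t ∸ s

module _ {P : Pred ℕ 0ℓ} (P? : Decidable P) where

  count-mono-range : ∀ {T U} → T ≤ U → count P? T ≤ count P? U
  count-mono-range {T} {U} T≤U = begin
    count P? T                                  ≤⟨ m≤m+n _ _ ⟩
    count P? T + ∑[ u < U ∸ T ] 𝟙 (P? (T + u))  ≡⟨ ∑-++ (λ t → 𝟙 (P? t)) T (U ∸ T) ⟨
    count P? (T + (U ∸ T))                      ≡⟨ cong (count P?) (m+[n∸m]≡n T≤U) ⟩
    count P? U                                  ∎
    where open ≤-Reasoning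

  module _ {d : ℕ} (sep : Separated d P) where

    count-window : ∀ a U → U ≤ d → count (λ t → P? (a + t)) U ≤ 1
    count-window a zero    _    = z≤n
    count-window a (suc U) U<d with P? (a + U)
    ... | no _  = ≤-trans (≤-reflexive (+-identityʳ _)) (count-window a U (<⇒≤ U<d))
    ... | yes p = ≤-reflexive (cong (_+ 1) (n≤0⇒n≡0 (≮⇒≥ no-earlier-hit)))
      where
      no-earlier-hit : ¬ 0 < count (λ t → P? (a + t)) U
      no-earlier-hit hit with count>0⇒∃ (λ t → P? (a + t)) U hit
      ... | s , s<U , ps = <⇒≱ U<d (begin
        d               ≤⟨ sep (+-monoʳ-< a s<U) ps p ⟩
        a + U ∸ (a + s) ≡⟨ [m+n]∸[m+o]≡n∸o a U s ⟩
        U ∸ s           ≤⟨ m∸n≤m U s ⟩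
        U               ∎)
        where open ≤-Reasoning

    count-blocks : ∀ q → count P? (q * d) ≤ q
    count-blocks zero    = z≤n
    count-blocks (suc q) = begin
      count P? (d + q * d)                                 ≡⟨ cong (count P?) (+-comm d (q * d)) ⟩
      count P? (q * d + d)                                 ≡⟨ ∑-++ (λ t → 𝟙 (P? t)) (q * d) d ⟩
      count P? (q * d) + count (λ t → P? (q * d + t)) d ≤⟨ +-mono-≤ (count-blocks q) (count-window (q * d) d ≤-refl) ⟩
      q + 1                                                ≡⟨ +-comm q 1 ⟩
      suc q                                                ∎
      where open ≤-Reasoning

    count-separated : .{{_ : NonZero d}} → ∀ T → count P? T * d ≤ T + d
    count-separated T = begin
      count P? T * d               ≤⟨ *-monoˡ-≤ d (count-mono-range T≤q*d) ⟩
      count P? (q * d) * d         ≤⟨ *-monoˡ-≤ d (count-blocks q) ⟩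
      q * d                        ≡⟨ +-comm d (T / d * d) ⟩
      T / d * d + d                ≤⟨ +-monoˡ-≤ d (m≤n+m (T / d * d) (T % d)) ⟩
      T % d + T / d * d + d        ≡⟨ cong (_+ d) (m≡m%n+[m/n]*n T d) ⟨
      T + d                        ∎
      where
      open ≤-Reasoning
      q = suc (T / d)
      T≤q*d : T ≤ q * d
      T≤q*d = begin
        T                  ≡⟨ m≡m%n+[m/n]*n T d ⟩
        T % d + T / d * d  ≤⟨ +-monoˡ-≤ (T / d * d) (<⇒≤ (m%n<n T d)) ⟩
        q * d              ∎

module _ {Q X T : ℕ} (f : ℕ → ℕ) (1≤Q : 1 ≤ Q) (f≡0 : ∀ d → d ≤ Q → f d ≡ 0)
         (f≤ : ∀ d → d ≤ T → f d * d * d ≤ X) where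

  -- With V = Q + W this is the discrete form of ∑_{Q < d ≤ V} 1/d² ≤ 1/Q − 1/V,
  -- proved by telescoping 1/(V+1)² ≤ 1/V − 1/(V+1).
  ∑-inverse-square-telescope : ∀ W → Q + W ≤ T → Q * (Q + W) * ∑[ d < suc (Q + W) ] f d ≤ X * W
  ∑-inverse-square-telescope zero _ = ≤-reflexive (begin-equality
    Q * (Q + 0) * ∑[ d < suc (Q + 0) ] f d ≡⟨ cong (Q * (Q + 0) *_) S≡0 ⟩
    Q * (Q + 0) * 0                        ≡⟨ *-zeroʳ (Q * (Q + 0)) ⟩
    0                                      ≡⟨ *-zeroʳ X ⟨
    X * 0                                  ∎)
    where
    open ≤-Reasoning
    S≡0 : ∑[ d < suc (Q + 0) ] f d ≡ 0
    S≡0 = ∑-zero f (suc (Q + 0)) λ d d≤Q → f≡0 d (≤-trans (≤-pred d≤Q) (≤-reflexive (+-identityʳ Q)))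
  ∑-inverse-square-telescope (suc W) Q+W<T rewrite +-suc Q W =
    *-cancelˡ-≤ V {{>-nonZero (≤-trans 1≤Q (m≤m+n Q W))}} (begin
      V * (Q * suc V * (S + c))                   ≡⟨ expand Q W S c ⟩
      suc V * (Q * V * S) + Q * (c * V * suc V)   ≤⟨ +-mono-≤ (*-monoʳ-≤ (suc V) (∑-inverse-square-telescope W (<⇒≤ Q+W<T)))
                                                              (*-monoʳ-≤ Q c*V*[V+1]≤X) ⟩
      suc V * (X * W) + Q * X                     ≡⟨ collect Q W X ⟩
      V * (X * suc W)                             ∎)
    where
    open ≤-Reasoning
    V = Q + W
    S = ∑[ d < suc V ] f d
    c = f (suc V)
    c*V*[V+1]≤X : c * V * suc V ≤ X
    c*V*[V+1]≤X = ≤-trans (*-monoˡ-≤ (suc V) (*-monoʳ-≤ c (n≤1+n V))) (f≤ _ Q+W<T)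
    expand : ∀ q w s c → (q + w) * (q * suc (q + w) * (s + c)) ≡
                         suc (q + w) * (q * (q + w) * s) + q * (c * (q + w) * suc (q + w))
    expand = solve-∀
    collect : ∀ q w x → suc (q + w) * (x * w) + q * x ≡ (q + w) * (x * suc w)
    collect = solve-∀

  ∑-inverse-square : Q * ∑[ d < suc T ] f d ≤ X
  ∑-inverse-square with Q ≤? T
  ... | yes Q≤T = *-cancelˡ-≤ T {{>-nonZero (≤-trans 1≤Q Q≤T)}} (begin
    T * (Q * S T)                        ≡⟨ x∙yz≈y∙xz T Q (S T) ⟩
    Q * (T * S T)                        ≡⟨ *-assoc Q T (S T) ⟨
    Q * T * S T                          ≡⟨ cong (λ V → Q * V * S V) (m+[n∸m]≡n Q≤T) ⟨
    Q * (Q + (T ∸ Q)) * S (Q + (T ∸ Q))  ≤⟨ ∑-inverse-square-telescope (T ∸ Q) (≤-reflexive (m+[n∸m]≡n Q≤T)) ⟩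
    X * (T ∸ Q)                          ≤⟨ *-monoʳ-≤ X (m∸n≤m T Q) ⟩
    X * T                                ≡⟨ *-comm X T ⟩
    T * X                                ∎)
    where
    open ≤-Reasoning
    S : ℕ → ℕ
    S V = ∑[ d < suc V ] f d
  ... | no Q≰T = ≤-trans (≤-reflexive (trans (cong (Q *_) S≡0) (*-zeroʳ Q))) z≤n
    where
    S≡0 : ∑[ d < suc T ] f d ≡ 0
    S≡0 = ∑-zero f (suc T) λ d d≤T → f≡0 d (≤-trans (≤-pred d≤T) (<⇒≤ (≰⇒> Q≰T)))

coprime-*ˡ : ∀ {a b x} → Coprime a x → Coprime b x → Coprime (a * b) x
coprime-*ˡ {a} {b} a⊥x b⊥x (d∣ab , d∣x) = b⊥x (coprime-divisor d⊥a d∣ab , d∣x)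
  where
  d⊥a : Coprime _ a
  d⊥a (e∣d , e∣a) = a⊥x (e∣a , ∣-trans e∣d d∣x)

coprime-∣⇒*-∣ : ∀ {a b N} → Coprime a b → a ∣ N → b ∣ N → a * b ∣ N
coprime-∣⇒*-∣ {a} {b} a⊥b a∣N b∣N = subst (_∣ _) lcm≡ab (lcm-least a∣N b∣N)
  where
  lcm≡ab : lcm a b ≡ a * b
  lcm≡ab = trans (sym (*-identityˡ (lcm a b)))
                 (trans (cong (_* lcm a b) (sym (coprime⇒gcd≡1 a⊥b))) (gcd*lcm a b))

module _ {P : Pred ℕ 0ℓ} (P? : Decidable P) (g : ℕ → ℕ) where

  ∏ : ℕ → ℕ
  ∏ zero = 1
  ∏ (suc U) with P? U
  ... | yes _ = ∏ U * g U
  ... | no  _ = ∏ U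

  ∏-coprime : ∀ {x} U → (∀ t → t < U → P t → Coprime (g t) x) → Coprime (∏ U) x
  ∏-coprime zero    g⊥x = 1-coprimeTo _
  ∏-coprime (suc U) g⊥x with P? U
  ... | yes p = coprime-*ˡ (∏-coprime U λ t t<U → g⊥x t (m<n⇒m<1+n t<U)) (g⊥x U ≤-refl p)
  ... | no  _ = ∏-coprime U λ t t<U → g⊥x t (m<n⇒m<1+n t<U)

  ∏-∣ : ∀ {N} U → (∀ t → t < U → P t → g t ∣ N) →
        (∀ s t → s < t → t < U → P s → P t → Coprime (g s) (g t)) → ∏ U ∣ N
  ∏-∣ zero    g∣N pairwise = 1∣ _
  ∏-∣ (suc U) g∣N pairwise with P? U
  ... | yes p = coprime-∣⇒*-∣ (∏-coprime U λ s s<U ps → pairwise s U s<U ≤-refl ps p)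
                             (∏-∣ U g∣N′ pairwise′) (g∣N U ≤-refl p)
    where
    g∣N′ = λ t t<U → g∣N t (m<n⇒m<1+n t<U)
    pairwise′ = λ s t s<t t<U → pairwise s t s<t (m<n⇒m<1+n t<U)
  ... | no _ = ∏-∣ U (λ t t<U → g∣N t (m<n⇒m<1+n t<U)) (λ s t s<t t<U → pairwise s t s<t (m<n⇒m<1+n t<U))

  2^count≤∏ : ∀ U → (∀ t → t < U → P t → 2 ≤ g t) → 2 ^ count P? U ≤ ∏ U
  2^count≤∏ zero    2≤g = ≤-refl
  2^count≤∏ (suc U) 2≤g with P? U
  ... | yes p = begin
    2 ^ (count P? U + 1)  ≡⟨ ^-distribˡ-+-* 2 (count P? U) 1 ⟩
    2 ^ count P? U * 2    ≤⟨ *-mono-≤ (2^count≤∏ U λ t t<U → 2≤g t (m<n⇒m<1+n t<U)) (2≤g U ≤-refl p) ⟩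
    ∏ U * g U             ∎
    where open ≤-Reasoning
  ... | no _ = ≤-trans (≤-reflexive (cong (2 ^_) (+-identityʳ (count P? U))))
                       (2^count≤∏ U λ t t<U → 2≤g t (m<n⇒m<1+n t<U))

  pairwise-coprime-divisors : ∀ {N} .{{_ : NonZero N}} U →
    (∀ t → t < U → P t → 2 ≤ g t × g t ∣ N) →
    (∀ s t → s < t → t < U → P s → P t → Coprime (g s) (g t)) → 2 ^ count P? U ≤ N
  pairwise-coprime-divisors U g-div pairwise =
    ≤-trans (2^count≤∏ U λ t t<U p → proj₁ (g-div t t<U p))
            (∣⇒≤ (∏-∣ U (λ t t<U p → proj₂ (g-div t t<U p)) pairwise))

box : ∀ n → ℕ → {P : Pred (Vector ℕ n) 0ℓ} → Decidable P → ℕ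
box zero    T P? = 𝟙 (P? [])
box (suc n) T P? = ∑[ t < T ] box n T (λ x → P? (t ∷ x))

box-∅ : ∀ {n} T {P : Pred (Vector ℕ n) 0ℓ} (P? : Decidable P) → (∀ x → ¬ P x) → box n T P? ≡ 0
box-∅ {zero}  T P? ¬P = 𝟙-∅ (P? []) (¬P [])
box-∅ {suc n} T P? ¬P = ∑-zero _ T λ t _ → box-∅ T (λ x → P? (t ∷ x)) (λ x → ¬P (t ∷ x))

box-mono : ∀ {n} T {P R : Pred (Vector ℕ n) 0ℓ} (P? : Decidable P) (R? : Decidable R) →
           (∀ x → P x → R x) → box n T P? ≤ box n T R?
box-mono {zero}  T P? R? P⇒R = 𝟙-mono (P? []) (R? []) (P⇒R [])
box-mono {suc n} T P? R? P⇒R = ∑-mono-≤ T λ t _ → box-mono T (λ x → P? (t ∷ x)) (λ x → R? (t ∷ x)) (λ x → P⇒R (t ∷ x))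

box-⊎ : ∀ {n} T {P R S : Pred (Vector ℕ n) 0ℓ} (P? : Decidable P) (R? : Decidable R) (S? : Decidable S) →
        (∀ x → P x → R x ⊎ S x) → box n T P? ≤ box n T R? + box n T S?
box-⊎ {zero}  T P? R? S? P⇒R⊎S = 𝟙-⊎ (P? []) (R? []) (S? []) (P⇒R⊎S [])
box-⊎ {suc n} T P? R? S? P⇒R⊎S = ≤-trans
  (∑-mono-≤ T λ t _ → box-⊎ T (λ x → P? (t ∷ x)) (λ x → R? (t ∷ x)) (λ x → S? (t ∷ x)) (λ x → P⇒R⊎S (t ∷ x)))
  (≤-reflexive (∑-distrib-+ T))

-- The weight k lets the union bound be nested without dividing.
box-∃ : ∀ {n m} T k X {P : Pred (Vector ℕ n) 0ℓ} {R : Fin m → Pred (Vector ℕ n) 0ℓ}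
        (P? : Decidable P) (R? : ∀ i → Decidable (R i)) →
        (∀ x → P x → ∃ λ i → R i x) → (∀ i → k * box n T (R? i) ≤ X) → k * box n T P? ≤ m * X
box-∃ {m = zero} T k X P? R? P⇒∃R kR≤X = ≤-reflexive (begin-equality
  k * box _ T P? ≡⟨ cong (k *_) (box-∅ T P? λ x p → ∃Fin0 (P⇒∃R x p)) ⟩
  k * 0          ≡⟨ *-zeroʳ k ⟩
  0              ∎)
  where
  open ≤-Reasoning
  ∃Fin0 : ∀ {A : Fin 0 → Set} → ¬ ∃ A
  ∃Fin0 (() , _)
box-∃ {m = suc m} T k X {R = R} P? R? P⇒∃R kR≤X = begin
  k * box _ T P?                                         ≤⟨ *-monoʳ-≤ k (box-⊎ T P? (R? zero) R⁺? split) ⟩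
  k * (box _ T (R? zero) + box _ T R⁺?)                  ≡⟨ *-distribˡ-+ k _ _ ⟩
  k * box _ T (R? zero) + k * box _ T R⁺?                ≤⟨ +-mono-≤ (kR≤X zero)
                                                              (box-∃ T k X R⁺? (R? ∘ suc) (λ _ r → r) (kR≤X ∘ suc)) ⟩
  X + m * X                                              ∎
  where
  open ≤-Reasoning
  R⁺? : Decidable (λ x → ∃ λ i → R (suc i) x)
  R⁺? x = any? (λ i → R? (suc i) x)
  split : ∀ x → _ → R zero x ⊎ ∃ λ i → R (suc i) x
  split x p with P⇒∃R x p
  ... | zero  , r = inj₁ r
  ... | suc i , r = inj₂ (i , r)

box-const : ∀ {n} T {A : Set} (A? : Dec A) → box n T (λ _ → A?) ≡ 𝟙 A? * T ^ n
box-const {zero}  T A? = sym (*-identityʳ (𝟙 A?))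
box-const {suc n} T A? = begin
  ∑[ t < T ] box n T (λ _ → A?) ≡⟨ ∑-cong T (λ _ _ → box-const {n} T A?) ⟩
  ∑[ t < T ] (𝟙 A? * T ^ n)     ≡⟨ ∑-const _ T ⟩
  T * (𝟙 A? * T ^ n)            ≡⟨ x∙yz≈y∙xz T (𝟙 A?) (T ^ n) ⟩
  𝟙 A? * (T * T ^ n)            ∎
  where open ≡-Reasoning

box<⇒∃¬ : ∀ {n} T {P : Pred (Vector ℕ n) 0ℓ} (P? : Decidable P) →
          box n T P? < T ^ n → ∃ λ x → (∀ i → x i < T) × ¬ P x
box<⇒∃¬ {zero} T P? box<1 with P? []
... | no ¬p = [] , (λ ()) , ¬p
... | yes _ with box<1
...   | s≤s ()
box<⇒∃¬ {suc n} T P? box<T^n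
  with ∑<*⇒∃< (λ t → box n T (λ x → P? (t ∷ x))) T (T ^ n) box<T^n
... | t , t<T , box<T^n′ with box<⇒∃¬ T (λ x → P? (t ∷ x)) box<T^n′
...   | x , x<T , ¬p = t ∷ x , bounded , ¬p
  where
  bounded : ∀ i → (t ∷ x) i < T
  bounded zero    = t<T
  bounded (suc i) = x<T i

box-coordinate : ∀ {n} T {P : Pred ℕ 0ℓ} (P? : Decidable P) (j : Fin n) →
                 T * box n T (λ x → P? (x j)) ≡ T ^ n * count P? T
box-coordinate {suc n} T P? zero = begin
  T * ∑[ t < T ] box n T (λ _ → P? t) ≡⟨ cong (T *_) (∑-cong T λ t _ → trans (box-const {n} T (P? t)) (*-comm (𝟙 (P? t)) (T ^ n))) ⟩
  T * ∑[ t < T ] (T ^ n * 𝟙 (P? t))   ≡⟨ cong (T *_) (*-distribˡ-∑ (T ^ n) _ T) ⟩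
  T * (T ^ n * count P? T)            ≡⟨ *-assoc T (T ^ n) _ ⟨
  T * T ^ n * count P? T              ∎
  where open ≡-Reasoning
box-coordinate {suc n} T P? (suc j) = begin
  T * ∑[ t < T ] box n T (λ x → P? (x j)) ≡⟨ cong (T *_) (∑-const _ T) ⟩
  T * (T * box n T (λ x → P? (x j)))      ≡⟨ cong (T *_) (box-coordinate T P? j) ⟩
  T * (T ^ n * count P? T)                ≡⟨ *-assoc T (T ^ n) _ ⟨
  T * T ^ n * count P? T                  ∎
  where open ≡-Reasoning

box-pair : ∀ {n} T {R : B.Rel ℕ 0ℓ} (R? : B.Decidable R) {i j : Fin n} → i Fin.< j →
           T * T * box n T (λ x → R? (x i) (x j)) ≡ T ^ n * count² R? T
box-pair {suc n} T R? {zero} {suc j} _ = begin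
  T * T * ∑[ s < T ] box n T (λ x → R? s (x j))   ≡⟨ *-assoc T T _ ⟩
  T * (T * ∑[ s < T ] box n T (λ x → R? s (x j))) ≡⟨ cong (T *_) (*-distribˡ-∑ T _ T) ⟨
  T * ∑[ s < T ] (T * box n T (λ x → R? s (x j))) ≡⟨ cong (T *_) (∑-cong T λ s _ → box-coordinate T (R? s) j) ⟩
  T * ∑[ s < T ] (T ^ n * count (R? s) T)         ≡⟨ cong (T *_) (*-distribˡ-∑ (T ^ n) _ T) ⟩
  T * (T ^ n * count² R? T)                       ≡⟨ *-assoc T (T ^ n) _ ⟨
  T * T ^ n * count² R? T                         ∎
  where open ≡-Reasoning
box-pair {suc n} T R? {suc i} {suc j} (s≤s i<j) = begin
  T * T * ∑[ t < T ] box n T (λ x → R? (x i) (x j)) ≡⟨ cong (T * T *_) (∑-const _ T) ⟩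
  T * T * (T * box n T (λ x → R? (x i) (x j)))      ≡⟨ x∙yz≈y∙xz (T * T) T _ ⟩
  T * (T * T * box n T (λ x → R? (x i) (x j)))      ≡⟨ cong (T *_) (box-pair T R? i<j) ⟩
  T * (T ^ n * count² R? T)                         ≡⟨ *-assoc T (T ^ n) _ ⟨
  T * T ^ n * count² R? T                           ∎
  where open ≡-Reasoning

module BadPairs {n} T .{{_ : NonZero T}} {R : Fin n → Fin n → B.Rel ℕ 0ℓ} (R? : ∀ i j → B.Decidable (R i j))
                (few : ∀ {i j} → i Fin.< j → n * n * count² (R? i j) T < T * T) where

  Bad : Fin n → Fin n → Pred (Vector ℕ n) 0ℓ
  Bad i j x = i Fin.< j × R i j (x i) (x j)

  Bad? : ∀ i j → Decidable (Bad i j)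
  Bad? i j x = (i Fin.<? j) ×-dec R? i j (x i) (x j)

  some-bad? : Decidable (λ x → ∃ λ i → ∃ λ j → Bad i j x)
  some-bad? x = any? λ i → any? λ j → Bad? i j x

  n*n*box-bad≤ : ∀ i j → n * n * box n T (Bad? i j) ≤ pred (T ^ n)
  n*n*box-bad≤ i j = by-order (i Fin.<? j)
    where
    by-order : Dec (i Fin.< j) → n * n * box n T (Bad? i j) ≤ pred (T ^ n)
    by-order (no i≮j) = ≤-trans (≤-reflexive (trans (cong (n * n *_) box≡0) (*-zeroʳ (n * n)))) z≤n
      where box≡0 = box-∅ T (Bad? i j) λ x b → i≮j (proj₁ b)
    by-order (yes i<j) = <⇒≤pred (begin-strict
      n * n * box n T (Bad? i j)                    ≤⟨ *-monoʳ-≤ (n * n) (box-mono T (Bad? i j) Rij? (λ x → proj₂)) ⟩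
      n * n * box n T Rij?                          <⟨ *-cancelˡ-< (T * T) _ _ (begin-strict
        T * T * (n * n * box n T Rij?)              ≡⟨ x∙yz≈y∙xz (T * T) (n * n) _ ⟩
        n * n * (T * T * box n T Rij?)              ≡⟨ cong (n * n *_) (box-pair T (R? i j) i<j) ⟩
        n * n * (T ^ n * count² (R? i j) T)         ≡⟨ x∙yz≈y∙xz (n * n) (T ^ n) _ ⟩
        T ^ n * (n * n * count² (R? i j) T)         <⟨ *-monoʳ-< (T ^ n) {{m^n≢0 T n}} (few i<j) ⟩
        T ^ n * (T * T)                             ≡⟨ *-comm (T ^ n) (T * T) ⟩
        T * T * T ^ n                               ∎) ⟩
      T ^ n                                         ∎)
      where
      open ≤-Reasoning
      Rij? = λ x → R? i j (x i) (x j)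

  n*n*box-some-bad≤ : n * n * box n T some-bad? ≤ n * (n * pred (T ^ n))
  n*n*box-some-bad≤ = box-∃ T (n * n) (n * pred (T ^ n)) some-bad? (λ i x → any? λ j → Bad? i j x) (λ x b → b)
    λ i → box-∃ T (n * n) (pred (T ^ n)) _ (Bad? i) (λ x b → b) (n*n*box-bad≤ i)

avoid-bad-pairs : ∀ {n} T .{{_ : NonZero T}} {R : Fin n → Fin n → B.Rel ℕ 0ℓ} (R? : ∀ i j → B.Decidable (R i j)) →
  (∀ {i j} → i Fin.< j → n * n * count² (R? i j) T < T * T) →
  ∃ λ (x : Vector ℕ n) → (∀ i → x i < T) × (∀ {i j} → i Fin.< j → ¬ R i j (x i) (x j))
avoid-bad-pairs {zero}  T R? few = [] , (λ ()) , λ { {()} }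
avoid-bad-pairs {suc n} T R? few =
  let (x , x<T , no-bad) = box<⇒∃¬ T some-bad? box<T^n
  in  x , x<T , λ i<j r → no-bad (_ , _ , i<j , r)
  where
  open BadPairs T R? few
  m = suc n
  box<T^n : box m T some-bad? < T ^ m
  box<T^n = m≤pred[n]⇒suc[m]≤n {{m^n≢0 T m}} (*-cancelˡ-≤ (m * m)
    (≤-trans n*n*box-some-bad≤ (≤-reflexive (sym (*-assoc m m (pred (T ^ m)))))))

≢0∧≢1⇒2≤ : ∀ {m} → m ≢ 0 → m ≢ 1 → 2 ≤ m
≢0∧≢1⇒2≤ {zero}        m≢0 _   = contradiction refl m≢0
≢0∧≢1⇒2≤ {1}           _   m≢1 = contradiction refl m≢1
≢0∧≢1⇒2≤ {suc (suc _)} _   _   = s≤s (s≤s z≤n)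

-- The properties of t ↦ |a + r + Q! t| that the counting argument uses.
record Rough (Q : ℕ) (u : ℕ → ℕ) : Set where
  field
    nonZero    : ∀ t → NonZero (u t)
    rough      : ∀ {d t} → 2 ≤ d → d ≤ Q → ¬ d ∣ u t
    ∣-distance : ∀ {d s t} → s ≤ t → d ∣ u s → d ∣ u t → d ∣ t ∸ s

  separated : ∀ d → Separated d (λ t → d ∣ u t)
  separated d s<t d∣us d∣ut = ∣⇒≤ {{>-nonZero (m<n⇒0<n∸m s<t)}} (∣-distance (<⇒≤ s<t) d∣us d∣ut)

module PairEstimate {Q T e : ℕ} {u v : ℕ → ℕ} (ru : Rough Q u) (rv : Rough Q v)
                    (u<2^e : ∀ s → s < T → u s < 2 ^ e) where

  open Rough

  BigCommonDivisor : ℕ → ℕ → ℕ → Set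
  BigCommonDivisor d s t = (Q < d × d ∣ u s) × d ∣ v t

  Small : ℕ → ℕ → Set
  Small s t = ∃ λ d → d < suc T × BigCommonDivisor d s t

  Small? : ∀ s t → Dec (Small s t)
  Small? s t = anyUpTo? (λ d → ((Q <? d) ×-dec (d ∣? u s)) ×-dec (d ∣? v t)) (suc T)

  NonCoprime? : ∀ s t → Dec (¬ Coprime (u s) (v t))
  NonCoprime? s t = ¬? (coprime? (u s) (v t))

  Large? : ∀ s t → Dec (¬ Coprime (u s) (v t) × ¬ Small s t)
  Large? s t = NonCoprime? s t ×-dec ¬? (Small? s t)

  small-pairs : 1 ≤ Q → Q * count² Small? T ≤ (T + T) * (T + T)
  small-pairs 1≤Q = begin
    Q * count² Small? T                        ≤⟨ *-monoʳ-≤ Q (∑-mono-≤ T λ s _ → count-∃ (Small? s) _ T (suc T) λ t _ small → small) ⟩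
    Q * ∑[ s < T ] ∑[ d < suc T ] count (C? d s) T ≡⟨ cong (Q *_) (∑-comm _ T (suc T)) ⟩
    Q * ∑[ d < suc T ] count² (C? d) T         ≡⟨ cong (Q *_) (∑-cong (suc T) λ d _ → count²-× (Cu? d) (Cv? d) T) ⟩
    Q * ∑[ d < suc T ] f d                     ≤⟨ ∑-inverse-square f 1≤Q f≡0 f*d*d≤ ⟩
    (T + T) * (T + T)                          ∎
    where
    open ≤-Reasoning
    Cu? = λ d s → (Q <? d) ×-dec (d ∣? u s)
    Cv? = λ d t → d ∣? v t
    C? = λ d s t → Cu? d s ×-dec Cv? d t
    f : ℕ → ℕ
    f d = count (Cu? d) T * count (Cv? d) T
    f≡0 : ∀ d → d ≤ Q → f d ≡ 0
    f≡0 d d≤Q = cong (_* count (Cv? d) T) (count-∅ (Cu? d) T λ _ _ c → <⇒≱ (proj₁ c) d≤Q)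
    f*d*d≤ : ∀ d → d ≤ T → f d * d * d ≤ (T + T) * (T + T)
    f*d*d≤ zero    _   = ≤-trans (≤-reflexive (*-zeroʳ (f 0 * 0))) z≤n
    f*d*d≤ d@(suc _) d≤T = begin
      f d * d * d                                        ≡⟨ x*y*z*z≡[x*z]*[y*z] (count (Cu? d) T) (count (Cv? d) T) d ⟩
      count (Cu? d) T * d * (count (Cv? d) T * d)
        ≤⟨ *-monoˡ-≤ (count (Cv? d) T * d) (*-monoˡ-≤ d (count-mono (Cu? d) (λ s → d ∣? u s) T λ _ _ → proj₂)) ⟩
      count (λ s → d ∣? u s) T * d * (count (Cv? d) T * d)
        ≤⟨ *-mono-≤ (count-separated _ (separated ru d) T) (count-separated _ (separated rv d) T) ⟩
      (T + d) * (T + d)                                  ≤⟨ *-mono-≤ (+-monoʳ-≤ T d≤T) (+-monoʳ-≤ T d≤T) ⟩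
      (T + T) * (T + T)                                  ∎
      where
      x*y*z*z≡[x*z]*[y*z] : ∀ x y z → x * y * z * z ≡ x * z * (y * z)
      x*y*z*z≡[x*z]*[y*z] = solve-∀

  -- For fixed s, the gcds of u s with the v t of large pairs are pairwise coprime divisors of u s.
  large-row : ∀ {s} → s < T → count (Large? s) T < e
  large-row {s} s<T = ≰⇒> λ e≤count → <⇒≱ (u<2^e s s<T) (begin
    2 ^ e                  ≤⟨ ^-monoʳ-≤ 2 e≤count ⟩
    2 ^ count (Large? s) T ≤⟨ pairwise-coprime-divisors (Large? s) g {{nonZero ru s}} T g-divides g-coprime ⟩
    u s                    ∎)
    where
    open ≤-Reasoning
    us≢0 : u s ≢ 0
    us≢0 = ≢-nonZero⁻¹ (u s) {{nonZero ru s}}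
    g : ℕ → ℕ
    g t = gcd (u s) (v t)
    g-divides : ∀ t → t < T → ¬ Coprime (u s) (v t) × ¬ Small s t → 2 ≤ g t × g t ∣ u s
    g-divides t _ (noncoprime , _) =
      ≢0∧≢1⇒2≤ (us≢0 ∘ gcd[m,n]≡0⇒m≡0) (noncoprime ∘ gcd≡1⇒coprime) , gcd[m,n]∣m (u s) (v t)
    common-divisor≡1 : ∀ {y t′ t} → t′ < t → t < T → ¬ Small s t → y ∣ u s → y ∣ v t′ → y ∣ v t → y ≡ 1
    common-divisor≡1 {zero} _ _ _ 0∣us _ _ = contradiction (0∣⇒≡0 0∣us) us≢0
    common-divisor≡1 {1}    _ _ _ _ _ _ = refl
    common-divisor≡1 {y@(suc (suc _))} {t′} {t} t′<t t<T not-small y∣us y∣vt′ y∣vt with y ≤? Q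
    ... | yes y≤Q = contradiction y∣vt (rough rv (s≤s (s≤s z≤n)) y≤Q)
    ... | no  y≰Q = contradiction (y , s≤s y≤T , (≰⇒> y≰Q , y∣us) , y∣vt) not-small
      where
      y≤T : y ≤ T
      y≤T = ≤-trans (separated rv y t′<t y∣vt′ y∣vt) (≤-trans (m∸n≤m t t′) (<⇒≤ t<T))
    g-coprime : ∀ t′ t → t′ < t → t < T → _ → ¬ Coprime (u s) (v t) × ¬ Small s t → Coprime (g t′) (g t)
    g-coprime t′ t t′<t t<T _ (_ , not-small) (y∣gt′ , y∣gt) = common-divisor≡1 t′<t t<T not-small
      (∣-trans y∣gt (gcd[m,n]∣m (u s) (v t)))
      (∣-trans y∣gt′ (gcd[m,n]∣n (u s) (v t′)))
      (∣-trans y∣gt (gcd[m,n]∣n (u s) (v t)))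

  noncoprime-pairs : count² NonCoprime? T ≤ count² Small? T + T * e
  noncoprime-pairs = begin
    count² NonCoprime? T                           ≤⟨ ∑-mono-≤ T (λ s _ → count-⊎ (NonCoprime? s) (Small? s) (Large? s) T (small-or-large s)) ⟩
    ∑[ s < T ] (count (Small? s) T + count (Large? s) T) ≡⟨ ∑-distrib-+ T ⟩
    count² Small? T + count² Large? T              ≤⟨ +-monoʳ-≤ (count² Small? T) (∑-mono-≤ T λ s s<T → <⇒≤ (large-row s<T)) ⟩
    count² Small? T + ∑[ s < T ] e                  ≡⟨ cong (count² Small? T +_) (∑-const e T) ⟩
    count² Small? T + T * e                         ∎
    where
    open ≤-Reasoning
    small-or-large : ∀ s t → ¬ Coprime (u s) (v t) → Small s t ⊎ (¬ Coprime (u s) (v t) × ¬ Small s t)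
    small-or-large s t noncoprime with Small? s t
    ... | yes small     = inj₁ small
    ... | no  not-small = inj₂ (noncoprime , not-small)

  few-noncoprime-pairs : ∀ {n} → 1 ≤ Q → 8 * (n * n) ≤ Q → 2 * (n * n) * e < T →
                         n * n * count² NonCoprime? T < T * T
  few-noncoprime-pairs {n} 1≤Q 8n²≤Q 2n²e<T = *-cancelˡ-< 2 _ _ (begin-strict
    2 * (n * n * count² NonCoprime? T)       ≤⟨ *-monoʳ-≤ 2 (*-monoʳ-≤ (n * n) noncoprime-pairs) ⟩
    2 * (n * n * (S + T * e))                ≡⟨ distribute (n * n) S T e ⟩
    2 * (n * n) * S + T * (2 * (n * n) * e)  <⟨ +-mono-≤-< small-part (*-monoʳ-< T {{>-nonZero (≤-<-trans z≤n 2n²e<T)}} 2n²e<T) ⟩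
    T * T + T * T                            ≡⟨ cong (T * T +_) (+-identityʳ (T * T)) ⟨
    2 * (T * T)                              ∎)
    where
    open ≤-Reasoning
    S = count² Small? T
    distribute : ∀ m S T e → 2 * (m * (S + T * e)) ≡ 2 * m * S + T * (2 * m * e)
    distribute = solve-∀
    small-part : 2 * (n * n) * S ≤ T * T
    small-part = *-cancelˡ-≤ 4 (begin
      4 * (2 * (n * n) * S) ≡⟨ regroup (n * n) S ⟩
      8 * (n * n) * S       ≤⟨ *-monoˡ-≤ S 8n²≤Q ⟩
      Q * S                 ≤⟨ small-pairs 1≤Q ⟩
      (T + T) * (T + T)     ≡⟨ double-square T ⟩
      4 * (T * T)           ∎)
      where
      regroup : ∀ m S → 4 * (2 * m * S) ≡ 8 * m * S
      regroup = solve-∀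
      double-square : ∀ T → (T + T) * (T + T) ≡ 4 * (T * T)
      double-square = solve-∀

module Progression (a : ℤ) (M : ℕ) .{{_ : NonZero M}} where

  open import Data.Integer using (+_)

  r : ℕ
  r = (1ℤ -ℤ a) %ℕ M

  r<M : r < M
  r<M = n%ℕd<d (1ℤ -ℤ a) M

  -- r is chosen so that a + r ≡ 1 (mod M), making every term coprime to M.
  term : ℕ → ℤ
  term t = a +ℤ + (r + M * t)

  private
    k : ℤ
    k = (1ℤ -ℤ a) /ℕ M

  term≡1+M* : ∀ t → term t ≡ 1ℤ +ℤ + M *ℤ (+ t -ℤ k)
  term≡1+M* t = begin
    a +ℤ + (r + M * t)                                ≡⟨ cong (a +ℤ_) (trans (ℤₚ.pos-+ r (M * t)) (cong (+ r +ℤ_) (ℤₚ.pos-* M t))) ⟩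
    a +ℤ (+ r +ℤ + M *ℤ + t)                           ≡⟨ cong (λ z → a +ℤ (z +ℤ + M *ℤ + t)) r≡ ⟩
    a +ℤ (((1ℤ -ℤ a) -ℤ k *ℤ + M) +ℤ + M *ℤ + t)      ≡⟨ simplify a k (+ M) (+ t) ⟩
    1ℤ +ℤ + M *ℤ (+ t -ℤ k)                            ∎
    where
    open ≡-Reasoning
    r≡ : + r ≡ (1ℤ -ℤ a) -ℤ k *ℤ + M
    r≡ = sym (trans (cong (_-ℤ k *ℤ + M) (a≡a%ℕn+[a/ℕn]*n (1ℤ -ℤ a) M)) (cancel (+ r) (k *ℤ + M)))
      where
      cancel : ∀ x y → (x +ℤ y) -ℤ y ≡ x
      cancel = ℤ-Ring.solve-∀
    simplify : ∀ a k m t → a +ℤ (((1ℤ -ℤ a) -ℤ k *ℤ m) +ℤ m *ℤ t) ≡ 1ℤ +ℤ m *ℤ (t -ℤ k)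
    simplify = ℤ-Ring.solve-∀

  term-+ : ∀ s d → term (s + d) ≡ term s +ℤ + (M * d)
  term-+ s d = begin
    a +ℤ + (r + M * (s + d))          ≡⟨ cong (λ z → a +ℤ + z) (regroup r M s d) ⟩
    a +ℤ + ((r + M * s) + M * d)      ≡⟨ cong (a +ℤ_) (ℤₚ.pos-+ (r + M * s) (M * d)) ⟩
    a +ℤ (+ (r + M * s) +ℤ + (M * d)) ≡⟨ ℤₚ.+-assoc a _ _ ⟨
    term s +ℤ + (M * d)               ∎
    where
    open ≡-Reasoning
    regroup : ∀ r m s d → r + m * (s + d) ≡ (r + m * s) + m * d
    regroup = solve-∀

  coprime-M : ∀ t → Coprime ∣ term t ∣ M
  coprime-M t {y} (y∣term , y∣M) = ∣1⇒≡1 (ℤ∣.∣⇒∣ᵤ {+ y} {1ℤ} (ℤ∣.∣m+n∣n⇒∣m y∣1+M* y∣M*))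
    where
    y∣1+M* : + y ℤ∣.∣ 1ℤ +ℤ + M *ℤ (+ t -ℤ k)
    y∣1+M* = subst (+ y ℤ∣.∣_) (term≡1+M* t) (ℤ∣.∣ᵤ⇒∣ {+ y} {term t} y∣term)
    y∣M* : + y ℤ∣.∣ + M *ℤ (+ t -ℤ k)
    y∣M* = ℤ∣.∣m⇒∣m*n (+ t -ℤ k) (ℤ∣.∣ᵤ⇒∣ {+ y} {+ M} y∣M)

  ∣-distance : ∀ {y s t} → s ≤ t → y ∣ ∣ term s ∣ → y ∣ ∣ term t ∣ → y ∣ t ∸ s
  ∣-distance {y} {s} {t} s≤t y∣s y∣t = coprime-divisor y⊥M (ℤ∣.∣⇒∣ᵤ y∣M*[t-s])
    where
    y∣s+M*[t-s] : + y ℤ∣.∣ term s +ℤ + (M * (t ∸ s))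
    y∣s+M*[t-s] = subst (+ y ℤ∣.∣_) (trans (cong term (sym (m+[n∸m]≡n s≤t))) (term-+ s (t ∸ s)))
                        (ℤ∣.∣ᵤ⇒∣ {+ y} {term t} y∣t)
    y∣M*[t-s] : + y ℤ∣.∣ + (M * (t ∸ s))
    y∣M*[t-s] = ℤ∣.∣m+n∣m⇒∣n {+ y} {term s} y∣s+M*[t-s] (ℤ∣.∣ᵤ⇒∣ {+ y} {term s} y∣s)
    y⊥M : Coprime y M
    y⊥M (e∣y , e∣M) = coprime-M s (∣-trans e∣y y∣s , e∣M)

  term≢0 : 2 ≤ M → ∀ t → NonZero ∣ term t ∣
  term≢0 2≤M t = ≢-nonZero λ term≡0 →
    <⇒≢ 2≤M (sym (coprime-M t (subst (M ∣_) (sym term≡0) (M ∣0) , ∣-refl)))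

  ∣term∣< : ∀ t → ∣ term t ∣ < ∣ a ∣ + M * suc t
  ∣term∣< t = begin-strict
    ∣ term t ∣           ≤⟨ ℤₚ.∣i+j∣≤∣i∣+∣j∣ a (+ (r + M * t)) ⟩
    ∣ a ∣ + (r + M * t)  <⟨ +-monoʳ-< ∣ a ∣ (+-monoˡ-< (M * t) r<M) ⟩
    ∣ a ∣ + (M + M * t)  ≡⟨ cong (λ z → ∣ a ∣ + z) (*-suc M t) ⟨
    ∣ a ∣ + M * suc t    ∎
    where open ≤-Reasoning

∣Q! : ∀ {d Q} → 1 ≤ d → d ≤ Q → d ∣ Q !
∣Q! {suc d} _ d≤Q = ∣-trans (m∣m*n (d !)) (m≤n⇒m!∣n! d≤Q)

rough-progression : ∀ (a : ℤ) Q → 2 ≤ Q → let open Progression a (Q !) {{Q !≢0}} in Rough Q (λ t → ∣ term t ∣)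
rough-progression a Q 2≤Q = record
  { nonZero    = term≢0 (≤-trans 2≤Q (∣⇒≤ {{Q !≢0}} (∣Q! (<⇒≤ 2≤Q) ≤-refl)))
  ; rough      = λ 2≤d d≤Q d∣term → <⇒≢ 2≤d (sym (coprime-M _ (d∣term , ∣Q! (<⇒≤ 2≤d) d≤Q)))
  ; ∣-distance = ∣-distance
  }
  where open Progression a (Q !) {{Q !≢0}}

module _ {P : Pred ℕ 0ℓ} (P? : Decidable P) where

  least : ∀ B → (∃ λ k → k ≤ B × P k) → ∃ λ H → H ≤ B × P H × (∀ k → P k → H ≤ k)
  least zero    (zero , _ , p) = zero , z≤n , p , λ _ _ → z≤n
  least (suc B) (k , k≤B+1 , p) with anyUpTo? P? (suc B)
  ... | yes (j , j<B+1 , pj) =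
    let (H , H≤B , pH , H-least) = least B (j , ≤-pred j<B+1 , pj) in H , m≤n⇒m≤1+n H≤B , pH , H-least
  ... | no none≤B = k , k≤B+1 , p , k-least
    where
    k-least : ∀ m → P m → k ≤ m
    k-least m pm with m ≤? B
    ... | yes m≤B = contradiction (m , s≤s m≤B , pm) none≤B
    ... | no  m≰B = ≤-trans k≤B+1 (≰⇒> m≰B)

any-∣∣≤? : {R : Pred ℤ 0ℓ} → Decidable R → ∀ H → Dec (∃ λ x → ∣ x ∣ ≤ H × R x)
any-∣∣≤? {R} R? H = map′ from to (anyUpTo? (λ k → R? (+ k) ⊎-dec R? (- + k)) (suc H))
  where
  open import Data.Integer using (+_)
  from : (∃ λ k → k < suc H × (R (+ k) ⊎ R (- + k))) → ∃ λ x → ∣ x ∣ ≤ H × R x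
  from (k , k<H+1 , inj₁ r) = + k , ≤-pred k<H+1 , r
  from (k , k<H+1 , inj₂ r) = - + k , subst (_≤ H) (sym (ℤₚ.∣-i∣≡∣i∣ (+ k))) (≤-pred k<H+1) , r
  to : (∃ λ x → ∣ x ∣ ≤ H × R x) → ∃ λ k → k < suc H × (R (+ k) ⊎ R (- + k))
  to (+ k      , k≤H , r) = k , s≤s k≤H , inj₁ r
  to (-[1+ k ] , k≤H , r) = suc k , s≤s k≤H , inj₂ r

∣xi∣≤height : ∀ {n} (x : Vector ℤ n) i → ∣ x i ∣ ≤ height x
∣xi∣≤height x zero    = m≤m⊔n _ _
∣xi∣≤height x (suc i) = ≤-trans (∣xi∣≤height (tail x) i) (m≤n⊔m _ _)

height≤ : ∀ {n} (x : Vector ℤ n) {X} → (∀ i → ∣ x i ∣ ≤ X) → height x ≤ X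
height≤ {zero}  x ∣x∣≤X = z≤n
height≤ {suc n} x ∣x∣≤X = ⊔-lub (∣x∣≤X zero) (height≤ (tail x) (∣x∣≤X ∘ suc))

any-height≤? : ∀ {n} {P : Pred (Vector ℤ n) 0ℓ} → Decidable P → P Respects _≗_ →
             ∀ H → Dec (∃ λ h → height h ≤ H × P h)
any-height≤? {zero} P? resp H = map′ (λ p → [] , z≤n , p) (λ (h , _ , p) → resp (λ ()) p) (P? [])
any-height≤? {suc n} {P} P? resp H =
  map′ from to (any-∣∣≤? (λ y → any-height≤? (λ h → P? (y ∷ h)) (λ h≗h′ → resp (∷-cong h≗h′)) H) H)
  where
  ∷-cong : ∀ {y} {h h′ : Vector ℤ n} → h ≗ h′ → (y ∷ h) ≗ (y ∷ h′)
  ∷-cong h≗h′ zero    = refl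
  ∷-cong h≗h′ (suc i) = h≗h′ i
  from : (∃ λ y → ∣ y ∣ ≤ H × ∃ λ h → height h ≤ H × P (y ∷ h)) → ∃ λ h → height h ≤ H × P h
  from (y , y≤H , h , h≤H , p) = y ∷ h , ⊔-lub y≤H h≤H , p
  to : (∃ λ h → height h ≤ H × P h) → ∃ λ y → ∣ y ∣ ≤ H × ∃ λ h → height h ≤ H × P (y ∷ h)
  to (h , h≤H , p) = head h , ≤-trans (m≤m⊔n _ _) h≤H , tail h , ≤-trans (m≤n⊔m _ _) h≤H ,
                     resp (λ { zero → refl ; (suc i) → refl }) p

PairwiseCoprimeShift? : ∀ {n} (a : Vector ℤ n) → Decidable (PairwiseCoprimeShift a)
PairwiseCoprimeShift? a h = all? λ i → all? λ j → (i Fin.<? j) →-dec (_ ℤ.≟ 1ℤ)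

PairwiseCoprimeShift-resp-≗ : ∀ {n} (a : Vector ℤ n) → PairwiseCoprimeShift a Respects _≗_
PairwiseCoprimeShift-resp-≗ a h≗h′ coprime i j i<j rewrite sym (h≗h′ i) | sym (h≗h′ j) = coprime i j i<j

IsL-exists : ∀ {n} (a h : Vector ℤ n) → PairwiseCoprimeShift a h → ∃ λ H → H ≤ height h × IsL a H
IsL-exists {n} a h coprime =
  let (H , H≤ , (h′ , h′≤H , coprime′) , H-least) = least Shift≤? (height h) (height h , ≤-refl , h , ≤-refl , coprime)
  in  H , H≤ , (h′ , ≤-antisym h′≤H (H-least (height h′) (h′ , ≤-refl , coprime′)) , coprime′) ,
      λ h″ coprime″ → H-least (height h″) (h″ , ≤-refl , coprime″)
  where
  Shift≤? : Decidable (λ H → ∃ λ h → height h ≤ H × PairwiseCoprimeShift a h)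
  Shift≤? = any-height≤? (PairwiseCoprimeShift? a) (PairwiseCoprimeShift-resp-≗ a)

small-coprime-shift : ∀ {n} (a : Vector ℤ n) {Q T e} → 2 ≤ Q → 8 * (n * n) ≤ Q → 2 * (n * n) * e < T →
  (∀ i → ∣ a i ∣ + Q ! * T ≤ 2 ^ e) → ∃ λ h → PairwiseCoprimeShift a h × height h ≤ Q ! * T
small-coprime-shift {n} a {Q} {T} {e} 2≤Q 8n²≤Q 2n²e<T a+QT≤2^e =
  let (x , x<T , coprime) = avoid-bad-pairs T {{T≢0}} Estimate.NonCoprime? (λ _ → few _ _)
  in  shift x , (λ i j i<j → cong +_ (coprime⇒gcd≡1 (decidable-stable (coprime? _ _) (coprime i<j)))) ,
      height≤ (shift x) (λ i → <⇒≤ (shift<M*T x i (x<T i)))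
  where
  open import Data.Integer using (+_)
  M = Q !
  instance
    M≢0 : NonZero M
    M≢0 = Q !≢0
  T≢0 : NonZero T
  T≢0 = >-nonZero (≤-<-trans z≤n 2n²e<T)
  open module Prog (i : Fin n) = Progression (a i) M using (r; r<M; term; ∣term∣<)
  u : Fin n → ℕ → ℕ
  u i t = ∣ term i t ∣
  u<2^e : ∀ i s → s < T → u i s < 2 ^ e
  u<2^e i s s<T = <-≤-trans (∣term∣< i s) (≤-trans (+-monoʳ-≤ ∣ a i ∣ (*-monoʳ-≤ M s<T)) (a+QT≤2^e i))
  module Estimate (i j : Fin n) = PairEstimate {e = e} (rough-progression (a i) Q 2≤Q) (rough-progression (a j) Q 2≤Q) (u<2^e i)
  few : ∀ i j → n * n * count² (Estimate.NonCoprime? i j) T < T * T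
  few i j = Estimate.few-noncoprime-pairs i j {n} (≤-trans (s≤s z≤n) 2≤Q) 8n²≤Q 2n²e<T
  shift : Vector ℕ n → Vector ℤ n
  shift x i = + (r i + M * x i)
  shift<M*T : ∀ x i → x i < T → ∣ shift x i ∣ < M * T
  shift<M*T x i xi<T = begin-strict
    r i + M * x i   <⟨ +-monoˡ-< (M * x i) (r<M i) ⟩
    M + M * x i     ≡⟨ *-suc M (x i) ⟨
    M * suc (x i)   ≤⟨ *-monoʳ-≤ M xi<T ⟩
    M * T           ∎
    where open ≤-Reasoning

n<2^n : ∀ n → n < 2 ^ n
n<2^n zero    = s≤s z≤n
n<2^n (suc n) = begin-strict
  suc n             <⟨ +-monoʳ-< 1 (n<2^n n) ⟩
  1 + 2 ^ n         ≤⟨ +-monoˡ-≤ (2 ^ n) (m^n>0 2 n) ⟩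
  2 ^ n + 2 ^ n     ≡⟨ cong (λ z → 2 ^ n + z) (+-identityʳ (2 ^ n)) ⟨
  2 ^ suc n         ∎
  where open ≤-Reasoning

exponential-beats-linear : ∀ A C → ∃ λ κ → A * (C + κ) < 2 ^ κ
exponential-beats-linear A C = p + p , (begin-strict
  A * (C + (p + p))            ≡⟨ expand A C p ⟩
  A * C + p * (2 * A)          ≤⟨ +-monoˡ-≤ (p * (2 * A)) (m≤n*m (A * C) p) ⟩
  p * (A * C) + p * (2 * A)    ≡⟨ *-distribˡ-+ p (A * C) (2 * A) ⟨
  p * (A * C + 2 * A)          <⟨ *-monoʳ-< p ≤-refl ⟩
  p * p                        ≤⟨ *-mono-≤ (<⇒≤ (n<2^n p)) (<⇒≤ (n<2^n p)) ⟩
  2 ^ p * 2 ^ p                ≡⟨ ^-distribˡ-+-* 2 p p ⟨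
  2 ^ (p + p)                  ∎)
  where
  open ≤-Reasoning
  p = suc (A * C + 2 * A)
  expand : ∀ A C p → A * (C + (p + p)) ≡ A * C + p * (2 * A)
  expand = solve-∀

n≤n^2 : ∀ n → n ≤ n ^ 2
n≤n^2 zero        = z≤n
n≤n^2 n@(suc _) = ≤-trans (m≤m*n n n) (≤-reflexive (cong (n *_) (sym (*-identityʳ n))))

1≤⌊log₂⌋ : ∀ {H} → 2 ≤ H → 1 ≤ ⌊log₂ H ⌋
1≤⌊log₂⌋ 2≤H = ≤-trans (≤-reflexive (sym (⌊log₂[2^n]⌋≡n 1))) (⌊log₂⌋-mono-≤ 2≤H)

<2^suc⌊log₂⌋ : ∀ H → H < 2 ^ suc ⌊log₂ H ⌋
<2^suc⌊log₂⌋ H with 2 ^ suc ⌊log₂ H ⌋ ≤? H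
... | no  2^L+1≰H = ≰⇒> 2^L+1≰H
... | yes 2^L+1≤H = contradiction (⌊log₂⌋-mono-≤ 2^L+1≤H)
                                  (<⇒≱ (≤-reflexive (sym (⌊log₂[2^n]⌋≡n (suc ⌊log₂ H ⌋)))))

module Parameters (n : ℕ) where

  Q : ℕ
  Q = 2 + 8 * (n * n)

  M : ℕ
  M = Q !

  κ : ℕ
  κ = proj₁ (exponential-beats-linear (2 * (n * n)) (M + 2))

  K : ℕ
  K = 2 ^ κ

  exponent : ℕ → ℕ
  exponent L = suc (M + κ + L)

  pairs-fit : ∀ {L} → 1 ≤ L → 2 * (n * n) * exponent L < K * L
  pairs-fit {L} 1≤L = begin-strict
    A * suc (M + κ + L)         ≤⟨ *-monoʳ-≤ A exponent≤ ⟩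
    A * ((M + 2 + κ) * L)       ≡⟨ *-assoc A _ L ⟨
    A * (M + 2 + κ) * L         <⟨ *-monoˡ-< L {{>-nonZero 1≤L}} (proj₂ (exponential-beats-linear A (M + 2))) ⟩
    K * L                       ∎
    where
    open ≤-Reasoning
    A = 2 * (n * n)
    collect : ∀ m κ L → suc (m + κ) * L + L ≡ (m + 2 + κ) * L
    collect = solve-∀
    exponent≤ : suc (M + κ + L) ≤ (M + 2 + κ) * L
    exponent≤ = ≤-trans (+-monoˡ-≤ L (m≤m*n (suc (M + κ)) L {{>-nonZero 1≤L}})) (≤-reflexive (collect M κ L))

  terms-fit : ∀ (a : Vector ℤ n) i → let L = ⌊log₂ height a ⌋ in ∣ a i ∣ + M * (K * L) ≤ 2 ^ exponent L
  terms-fit a i = begin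
    ∣ a i ∣ + M * (K * L)  ≤⟨ +-mono-≤ (<⇒≤ ∣ai∣<2^E) MKL≤2^E ⟩
    2 ^ E + 2 ^ E          ≡⟨ cong (λ z → 2 ^ E + z) (+-identityʳ (2 ^ E)) ⟨
    2 ^ suc E              ∎
    where
    open ≤-Reasoning
    L = ⌊log₂ height a ⌋
    E = M + κ + L
    ∣ai∣<2^E : ∣ a i ∣ < 2 ^ E
    ∣ai∣<2^E = <-≤-trans (≤-<-trans (∣xi∣≤height a i) (<2^suc⌊log₂⌋ (height a)))
                         (^-monoʳ-≤ 2 (+-monoˡ-≤ L (≤-trans (1≤n! Q) (m≤m+n M κ))))
    MKL≤2^E : M * (K * L) ≤ 2 ^ E
    MKL≤2^E = begin
      M * (K * L)                 ≤⟨ *-mono-≤ (<⇒≤ (n<2^n M)) (*-monoʳ-≤ K (<⇒≤ (n<2^n L))) ⟩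
      2 ^ M * (2 ^ κ * 2 ^ L)     ≡⟨ *-assoc (2 ^ M) (2 ^ κ) (2 ^ L) ⟨
      2 ^ M * 2 ^ κ * 2 ^ L       ≡⟨ cong (_* 2 ^ L) (^-distribˡ-+-* 2 M κ) ⟨
      2 ^ (M + κ) * 2 ^ L         ≡⟨ ^-distribˡ-+-* 2 (M + κ) L ⟨
      2 ^ E                       ∎

theorem2 : (n : ℕ) → Σ ℕ (λ c → (a : Fin n → ℤ) → 2 ≤ height a →
             Σ ℕ (λ H → IsL a H × H ≤ c * (⌊log₂ (height a) ⌋ ^ 2)))
theorem2 n = M * K , λ a 2≤H →
  let L = ⌊log₂ height a ⌋
      (h , coprime , h≤MKL) = small-coprime-shift a (s≤s (s≤s z≤n)) (m≤n+m _ 2) (pairs-fit (1≤⌊log₂⌋ 2≤H)) (terms-fit a)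
      (H , H≤h , isL) = IsL-exists a h coprime
  in  H , isL , (begin
    H                  ≤⟨ ≤-trans H≤h h≤MKL ⟩
    M * (K * L)        ≡⟨ *-assoc M K L ⟨
    M * K * L          ≤⟨ *-monoʳ-≤ (M * K) (n≤n^2 L) ⟩
    M * K * L ^ 2      ∎)
  where
  open Parameters n
  open ≤-Reasoning
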